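{- Let $p,q$ be integers with $2q\le p\le \frac{5}{2}q$. Then $m_{p,q}\le 2p-4q$.
   Context: A signed graph is a graph with a signature assigning $+$ or $-$ to each edge; a cycle is negative if it has an odd number of negative edges; a vertex set is balanced if it induces no negative cycle. A balanced $(p,q)$-coloring assigns to each vertex a set of $q$ colors from $\{1,\dots,p\}$ so that each color class is balanced. A color misses a set of vertices if no vertex of the set receives it. $m_{p,q}$ is the smallest integer $m$ such that there exists a planar signed simple graph $\widehat{T}$, embedded with outer face a negative triangle, such that in every balanced $(p,q)$-coloring of $\widehat{T}$ at most $m$ colors miss the vertices of the outer face. -}

module Defs where

open import Data.Nat using (ℕ; zero; suc; _+_; _*_; _≤_; _≤?_; _%_)
open import Data.Nat.DivMod using (m%n<n)
open import Data.Bool using (Bool; true; false; if_then_else_; not)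
import Data.Bool as B
open import Data.Fin using (Fin; toℕ; fromℕ<)
import Data.Fin as F
open import Data.Fin.Properties using (all?)
open import Data.List using (List; _∷_; []; map; cartesianProduct; allFin)
open import Data.Nat.ListAction using (sum)
open import Data.Product using (Σ; _×_; _,_; ∃)
open import Data.Sum using (_⊎_)
open import Relation.Nullary using (¬_; Dec)
open import Relation.Nullary.Decidable using (⌊_⌋)
open import Relation.Binary.PropositionalEquality using (_≡_; _≢_)
open import Function using (_∘_)
open import Function.Definitions using (Injective)

b2n : Bool → ℕ
b2n false = 0
b2n true = 1

data Sign : Set where
  pos neg : Sign

isNeg : Sign → Bool
isNeg pos = false
isNeg neg = true

record SignedGraph : Set where
  field
    n m  : ℕ
    end₁ : Fin m → Fin n
    end₂ : Fin m → Fin n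
    sign : Fin m → Sign

countTrue : (N : ℕ) → (Fin N → Bool) → ℕ
countTrue zero    f = 0
countTrue (suc N) f = (if f F.zero then 1 else 0) + countTrue N (f ∘ F.suc)

iter : {A : Set} → (A → A) → ℕ → A → A
iter f zero    x = x
iter f (suc k) x = f (iter f k x)

next : {k : ℕ} → Fin (suc k) → Fin (suc k)
next {k} i = fromℕ< (m%n<n (suc (toℕ i)) (suc k))

module _ (G : SignedGraph) where
  open SignedGraph G

  Joins : Fin m → Fin n → Fin n → Set
  Joins e u v = (end₁ e ≡ u × end₂ e ≡ v) ⊎ (end₁ e ≡ v × end₂ e ≡ u)

  Simple : Set
  Simple = (∀ e → end₁ e ≢ end₂ e)
         × (∀ e f u v → Joins e u v → Joins f u v → e ≡ f)

  NegativeCycleIn : (Fin n → Bool) → Set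
  NegativeCycleIn S =
    Σ ℕ λ k →
    Σ (Fin (3 + k) → Fin n) λ vs →
    Σ (Fin (3 + k) → Fin m) λ es →
      Injective _≡_ _≡_ vs
    × (∀ i → Joins (es i) (vs i) (vs (next i)))
    × (∀ i → S (vs i) ≡ true)
    × (countTrue (3 + k) (isNeg ∘ sign ∘ es) % 2 ≡ 1)

  Balanced : (Fin n → Bool) → Set
  Balanced S = ¬ NegativeCycleIn S

  record BalancedColoring (p q : ℕ) : Set where
    field
      col      : Fin n → Fin p → Bool
      size     : ∀ v → countTrue p (col v) ≡ q
      balanced : ∀ (i : Fin p) → Balanced (λ v → col v i)

  data Reach : Fin n → Fin n → Set where
    here : ∀ {u} → Reach u u
    step : ∀ {u w v} (e : Fin m) → Joins e u w → Reach w v → Reach u v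

  Connected : Set
  Connected = ∀ u v → Reach u v

  -- darts (half-edges): (e , false) sits at end₁ e, (e , true) at end₂ e
  Dart : Set
  Dart = Fin m × Bool

  dvert : Dart → Fin n
  dvert (e , false) = end₁ e
  dvert (e , true)  = end₂ e

  dedge : Dart → Fin m
  dedge (e , _) = e

  α : Dart → Dart
  α (e , b) = (e , not b)

  allDarts : List Dart
  allDarts = cartesianProduct (allFin m) (false ∷ true ∷ [])

  rank : Dart → ℕ
  rank (e , b) = toℕ e * 2 + b2n b

  -- rotation system: a permutation σ of the darts whose orbits are exactly
  -- the sets of darts at each vertex (the cyclic order around each vertex)
  record RotationSystem : Set where
    field
      σ      : Dart → Dart
      σ⁻¹    : Dart → Dart
      σσ⁻¹   : ∀ d → σ (σ⁻¹ d) ≡ d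
      σ⁻¹σ   : ∀ d → σ⁻¹ (σ d) ≡ d
      σ-vert : ∀ d → dvert (σ d) ≡ dvert d
      σ-tran : ∀ d d' → dvert d ≡ dvert d' → ∃ λ k → iter σ k d ≡ d'

    φ : Dart → Dart
    φ = σ ∘ α

    -- d is the rank-minimal dart of its φ-orbit (orbits have size ≤ 2m)
    isFaceRep : Dart → Bool
    isFaceRep d = ⌊ all? {n = m * 2} (λ k → rank d ≤? rank (iter φ (toℕ k) d)) ⌋

    numFaces : ℕ
    numFaces = sum (map (λ d → b2n (isFaceRep d)) allDarts)

-- Planarity: connected graph with a
-- rotation system of genus 0 (Euler: V - E + F = 2).  The outer face is the
-- φ-orbit of the dart d₀, which has length 3 through three distinct vertices,
-- and whose three edges contain an odd number of negative edges.
record PlaneGraphNegOuterTriangle : Set where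
  field
    G         : SignedGraph
  open SignedGraph G public
  field
    simple    : Simple G
    connected : Connected G
    rot       : RotationSystem G
  open RotationSystem rot public
  field
    euler     : n + numFaces ≡ m + 2
    d₀        : Dart G
    tri       : iter φ 3 d₀ ≡ d₀
    distinct₀₁ : dvert G d₀ ≢ dvert G (φ d₀)
    distinct₁₂ : dvert G (φ d₀) ≢ dvert G (φ (φ d₀))
    distinct₀₂ : dvert G d₀ ≢ dvert G (φ (φ d₀))
    negative  : (b2n (isNeg (sign (dedge G d₀)))
               + b2n (isNeg (sign (dedge G (φ d₀))))
               + b2n (isNeg (sign (dedge G (φ (φ d₀)))))) % 2 ≡ 1

  outer₀ outer₁ outer₂ : Fin n
  outer₀ = dvert G d₀
  outer₁ = dvert G (φ d₀)
  outer₂ = dvert G (φ (φ d₀))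

  missing : {p q : ℕ} → BalancedColoring G p q → ℕ
  missing {p} c = countTrue p (λ i →
    not (col outer₀ i) B.∧ not (col outer₁ i) B.∧ not (col outer₂ i))
    where open BalancedColoring c

{-# OPTIONS --safe #-}
module Submission where

-- Take K₄ with every edge negative, embedded with outer face 0 1 2 and vertex 3
-- inside. Every triangle of K₄ is negative, so a balanced colour class has at
-- most two vertices, and a colour missing the outer face is used at most on
-- vertex 3. Hence (missing colours) + |class i| ≤ 2 for each colour i; summing
-- over the p colours and counting the 4q vertex–colour incidences gives
-- (missing colours) + 4q ≤ 2p.

open import Defs
import Algebra.Properties.CommutativeMonoid.Sum as Sum
open import Data.Bool using (Bool; true; false; not; _∧_)
import Data.Bool.Properties as Bool
open import Data.Empty using (⊥-elim)
open import Data.Fin using (Fin; zero; suc)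
open import Data.Fin.Patterns using (0F; 1F; 2F; 3F; 4F; 5F)
open import Data.Fin.Properties using (all?) renaming (_≟_ to _≟ᶠ_)
open import Data.Nat using (ℕ; zero; suc; _+_; _*_; _∸_; _%_; _≤_; z≤n; s≤s)
open import Data.Nat.Properties
  using (+-0-commutativeMonoid; +-assoc; +-identityʳ; *-comm; +-mono-≤; ≤-refl; m+n≤o⇒m≤o∸n; module ≤-Reasoning)
open import Data.Product using (Σ; _,_; ∃; proj₁)
import Data.Product.Properties as Product
open import Data.Sum using (inj₁; inj₂)
open import Function using (_∘_)
open import Relation.Binary.PropositionalEquality
  using (_≡_; _≢_; refl; sym; trans; cong; cong₂; subst; module ≡-Reasoning)
open import Relation.Nullary using (Dec; ¬?; _×-dec_; _⊎-dec_; _→-dec_)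
open import Relation.Nullary.Decidable using (toWitness)

open Sum +-0-commutativeMonoid using (sum-syntax; ∑-comm; ∑-distrib-+; sum-cong-≗)

∑-const : ∀ n x → ∑[ i < n ] x ≡ n * x
∑-const zero    x = refl
∑-const (suc n) x = cong (x +_) (∑-const n x)

∑-mono-≤ : ∀ {n} {f g : Fin n → ℕ} → (∀ i → f i ≤ g i) → ∑[ i < n ] f i ≤ ∑[ i < n ] g i
∑-mono-≤ {zero}  f≤g = z≤n
∑-mono-≤ {suc n} f≤g = +-mono-≤ (f≤g zero) (∑-mono-≤ (f≤g ∘ suc))

countTrue≡∑ : ∀ n (f : Fin n → Bool) → countTrue n f ≡ ∑[ i < n ] b2n (f i)
countTrue≡∑ zero    f = refl
countTrue≡∑ (suc n) f with f zero
... | true  = cong suc (countTrue≡∑ n (f ∘ suc))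
... | false = countTrue≡∑ n (f ∘ suc)

module _ {G : SignedGraph} where
  open SignedGraph G

  Joins-sym : ∀ {e u v} → Joins G e u v → Joins G e v u
  Joins-sym (inj₁ ends) = inj₂ ends
  Joins-sym (inj₂ ends) = inj₁ ends

  Reach-trans : ∀ {u v w} → Reach G u v → Reach G v w → Reach G u w
  Reach-trans here           r = r
  Reach-trans (step e j u⇝v) r = step e j (Reach-trans u⇝v r)

  Reach-sym : ∀ {u v} → Reach G u v → Reach G v u
  Reach-sym here           = here
  Reach-sym (step e j w⇝v) = Reach-trans (Reach-sym w⇝v) (step e (Joins-sym j) here)

  connected-via : (h : Fin n) → (∀ v → Reach G v h) → Connected G
  connected-via h ⇝h u v = Reach-trans (⇝h u) (Reach-sym (⇝h v))

  Joins? : ∀ e u v → Dec (Joins G e u v)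
  Joins? e u v = (end₁ e ≟ᶠ u ×-dec end₂ e ≟ᶠ v) ⊎-dec (end₁ e ≟ᶠ v ×-dec end₂ e ≟ᶠ u)

  simple? : Dec (Simple G)
  simple? = all? (λ e → ¬? (end₁ e ≟ᶠ end₂ e))
      ×-dec all? λ e → all? λ f → all? λ u → all? λ v →
              Joins? e u v →-dec Joins? f u v →-dec e ≟ᶠ f

  negativeTriangle : (∀ e → end₁ e ≢ end₂ e) → ∀ {S a b c} (eab ebc eca : Fin m) →
    Joins G eab a b → Joins G ebc b c → Joins G eca c a →
    S a ≡ true → S b ≡ true → S c ≡ true →
    (b2n (isNeg (sign eab)) + b2n (isNeg (sign ebc)) + b2n (isNeg (sign eca))) % 2 ≡ 1 →
    NegativeCycleIn G S
  negativeTriangle loopless {S} {a} {b} {c} eab ebc eca jab jbc jca sa sb sc odd =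
    0 , vs , es , vs-injective , joins , inS , oddNegatives
    where
    distinct : ∀ {e u v} → Joins G e u v → u ≢ v
    distinct {e} (inj₁ (p , q)) u≡v = loopless e (trans p (trans u≡v (sym q)))
    distinct {e} (inj₂ (p , q)) u≡v = loopless e (trans p (trans (sym u≡v) (sym q)))
    a≢b : a ≢ b
    a≢b = distinct jab
    b≢c : b ≢ c
    b≢c = distinct jbc
    a≢c : a ≢ c
    a≢c = distinct (Joins-sym jca)
    vs : Fin 3 → Fin n
    vs 0F = a
    vs 1F = b
    vs 2F = c
    es : Fin 3 → Fin m
    es 0F = eab
    es 1F = ebc
    es 2F = eca
    vs-injective : ∀ {i j} → vs i ≡ vs j → i ≡ j
    vs-injective {0F} {0F} _ = refl
    vs-injective {0F} {1F} p = ⊥-elim (a≢b p)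
    vs-injective {0F} {2F} p = ⊥-elim (a≢c p)
    vs-injective {1F} {0F} p = ⊥-elim (a≢b (sym p))
    vs-injective {1F} {1F} _ = refl
    vs-injective {1F} {2F} p = ⊥-elim (b≢c p)
    vs-injective {2F} {0F} p = ⊥-elim (a≢c (sym p))
    vs-injective {2F} {1F} p = ⊥-elim (b≢c (sym p))
    vs-injective {2F} {2F} _ = refl
    joins : ∀ i → Joins G (es i) (vs i) (vs (next i))
    joins 0F = jab
    joins 1F = jbc
    joins 2F = jca
    inS : ∀ i → S (vs i) ≡ true
    inS 0F = sa
    inS 1F = sb
    inS 2F = sc
    oddNegatives : countTrue 3 (isNeg ∘ sign ∘ es) % 2 ≡ 1
    oddNegatives = subst (λ k → k % 2 ≡ 1) negatives≡countTrue odd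
      where
      open ≡-Reasoning
      x y z : ℕ
      x = b2n (isNeg (sign eab))
      y = b2n (isNeg (sign ebc))
      z = b2n (isNeg (sign eca))
      negatives≡countTrue : x + y + z ≡ countTrue 3 (isNeg ∘ sign ∘ es)
      negatives≡countTrue = begin
        x + y + z             ≡⟨ +-assoc x y z ⟩
        x + (y + z)           ≡⟨ cong (λ t → x + (y + t)) (+-identityʳ z) ⟨
        x + (y + (z + 0))     ≡⟨ countTrue≡∑ 3 (isNeg ∘ sign ∘ es) ⟨
        countTrue 3 (isNeg ∘ sign ∘ es) ∎

next³ : ∀ (j : Fin 3) → iter next 3 j ≡ j
next³ 0F = refl
next³ 1F = refl
next³ 2F = refl

next-transitive : ∀ (i j : Fin 3) → ∃ λ k → iter next k i ≡ j
next-transitive 0F 0F = 0 , refl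
next-transitive 0F 1F = 1 , refl
next-transitive 0F 2F = 2 , refl
next-transitive 1F 0F = 2 , refl
next-transitive 1F 1F = 0 , refl
next-transitive 1F 2F = 1 , refl
next-transitive 2F 0F = 1 , refl
next-transitive 2F 1F = 2 , refl
next-transitive 2F 2F = 0 , refl

module CubicRotation (G : SignedGraph)
  (dartAt : Fin (SignedGraph.n G) → Fin 3 → Dart G) (slot : Dart G → Fin 3)
  (dvert-dartAt : ∀ v j → dvert G (dartAt v j) ≡ v)
  (slot-dartAt : ∀ v j → slot (dartAt v j) ≡ j)
  (dartAt-slot : ∀ d → dartAt (dvert G d) (slot d) ≡ d)
  where

  σ : Dart G → Dart G
  σ d = dartAt (dvert G d) (next (slot d))

  σ-dartAt : ∀ v j → σ (dartAt v j) ≡ dartAt v (next j)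
  σ-dartAt v j rewrite dvert-dartAt v j | slot-dartAt v j = refl

  iter-σ-dartAt : ∀ k v j → iter σ k (dartAt v j) ≡ dartAt v (iter next k j)
  iter-σ-dartAt zero    v j = refl
  iter-σ-dartAt (suc k) v j = trans (cong σ (iter-σ-dartAt k v j)) (σ-dartAt v (iter next k j))

  σ³ : ∀ d → σ (σ (σ d)) ≡ d
  σ³ d = begin
    iter σ 3 d                               ≡⟨ cong (iter σ 3) (dartAt-slot d) ⟨
    iter σ 3 (dartAt (dvert G d) (slot d))   ≡⟨ iter-σ-dartAt 3 (dvert G d) (slot d) ⟩
    dartAt (dvert G d) (iter next 3 (slot d)) ≡⟨ cong (dartAt (dvert G d)) (next³ (slot d)) ⟩
    dartAt (dvert G d) (slot d)              ≡⟨ dartAt-slot d ⟩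
    d                                        ∎
    where open ≡-Reasoning

  σ-transitive : ∀ d d' → dvert G d ≡ dvert G d' → ∃ λ k → iter σ k d ≡ d'
  σ-transitive d d' same with next-transitive (slot d) (slot d')
  ... | k , d↦d' = k , (begin
    iter σ k d                                 ≡⟨ cong (iter σ k) (dartAt-slot d) ⟨
    iter σ k (dartAt (dvert G d) (slot d))     ≡⟨ iter-σ-dartAt k (dvert G d) (slot d) ⟩
    dartAt (dvert G d) (iter next k (slot d))  ≡⟨ cong₂ dartAt same d↦d' ⟩
    dartAt (dvert G d') (slot d')              ≡⟨ dartAt-slot d' ⟩
    d'                                         ∎)
    where open ≡-Reasoning

  rotationSystem : RotationSystem G
  rotationSystem = record
    { σ      = σ
    ; σ⁻¹    = σ ∘ σ
    ; σσ⁻¹   = σ³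
    ; σ⁻¹σ   = σ³
    ; σ-vert = λ d → dvert-dartAt (dvert G d) (next (slot d))
    ; σ-tran = σ-transitive
    }

module _ {G : SignedGraph} {p q : ℕ} (c : BalancedColoring G p q) where
  open SignedGraph G
  open BalancedColoring c

  ∑-classSizes : ∑[ i < p ] countTrue n (λ v → col v i) ≡ n * q
  ∑-classSizes = begin
    ∑[ i < p ] countTrue n (λ v → col v i)    ≡⟨ sum-cong-≗ (λ i → countTrue≡∑ n (λ v → col v i)) ⟩
    ∑[ i < p ] ∑[ v < n ] b2n (col v i)       ≡⟨ ∑-comm (λ i v → b2n (col v i)) ⟩
    ∑[ v < n ] ∑[ i < p ] b2n (col v i)       ≡⟨ sum-cong-≗ (λ v → trans (sym (countTrue≡∑ p (col v))) (size v)) ⟩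
    ∑[ v < n ] q                              ≡⟨ ∑-const n q ⟩
    n * q                                     ∎
    where open ≡-Reasoning

pattern fwd = inj₁ (refl , refl)
pattern bwd = inj₂ (refl , refl)

K4⁻ : SignedGraph
K4⁻ = record { n = 4 ; m = 6 ; end₁ = tail ; end₂ = head ; sign = λ _ → neg }
  where
  tail head : Fin 6 → Fin 4
  tail 0F = 0F
  tail 1F = 1F
  tail 2F = 2F
  tail 3F = 0F
  tail 4F = 1F
  tail 5F = 2F
  head 0F = 1F
  head 1F = 2F
  head 2F = 0F
  head 3F = 3F
  head 4F = 3F
  head 5F = 3F

module K4⁻-embedding where
  dartAt : Fin 4 → Fin 3 → Dart K4⁻
  dartAt 0F 0F = 0F , false
  dartAt 0F 1F = 3F , false
  dartAt 0F 2F = 2F , true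
  dartAt 1F 0F = 0F , true
  dartAt 1F 1F = 1F , false
  dartAt 1F 2F = 4F , false
  dartAt 2F 0F = 1F , true
  dartAt 2F 1F = 2F , false
  dartAt 2F 2F = 5F , false
  dartAt 3F 0F = 3F , true
  dartAt 3F 1F = 4F , true
  dartAt 3F 2F = 5F , true

  slot : Dart K4⁻ → Fin 3
  slot (0F , false) = 0F
  slot (3F , false) = 1F
  slot (2F , true)  = 2F
  slot (0F , true)  = 0F
  slot (1F , false) = 1F
  slot (4F , false) = 2F
  slot (1F , true)  = 0F
  slot (2F , false) = 1F
  slot (5F , false) = 2F
  slot (3F , true)  = 0F
  slot (4F , true)  = 1F
  slot (5F , true)  = 2F

  dartAt-slot? : ∀ d → Dec (dartAt (dvert K4⁻ d) (slot d) ≡ d)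
  dartAt-slot? d = Product.≡-dec _≟ᶠ_ Bool._≟_ (dartAt (dvert K4⁻ d) (slot d)) d

  dvert-dartAt : ∀ v j → dvert K4⁻ (dartAt v j) ≡ v
  dvert-dartAt = toWitness {a? = all? λ v → all? λ j → dvert K4⁻ (dartAt v j) ≟ᶠ v} _

  slot-dartAt : ∀ v j → slot (dartAt v j) ≡ j
  slot-dartAt = toWitness {a? = all? λ v → all? λ j → slot (dartAt v j) ≟ᶠ j} _

  dartAt-slot : ∀ d → dartAt (dvert K4⁻ d) (slot d) ≡ d
  dartAt-slot (e , false) = toWitness {a? = all? λ e → dartAt-slot? (e , false)} _ e
  dartAt-slot (e , true)  = toWitness {a? = all? λ e → dartAt-slot? (e , true)} _ e

  open CubicRotation K4⁻ dartAt slot dvert-dartAt slot-dartAt dartAt-slot public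
    using (rotationSystem)

K4⁻-simple : Simple K4⁻
K4⁻-simple = toWitness {a? = simple? {G = K4⁻}} _

K4⁻-plane : PlaneGraphNegOuterTriangle
K4⁻-plane = record
  { G          = K4⁻
  ; simple     = K4⁻-simple
  ; connected  = connected-via 3F reach-3
  ; rot        = K4⁻-embedding.rotationSystem
  ; euler      = refl
  ; d₀         = 0F , false
  ; tri        = refl
  ; distinct₀₁ = λ ()
  ; distinct₁₂ = λ ()
  ; distinct₀₂ = λ ()
  ; negative   = refl
  }
  where
  reach-3 : ∀ v → Reach K4⁻ v 3F
  reach-3 0F = step 3F fwd here
  reach-3 1F = step 4F fwd here
  reach-3 2F = step 5F fwd here
  reach-3 3F = here

K4⁻-negativeTriangle : ∀ S {a b c} (eab ebc eca : Fin 6) →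
  Joins K4⁻ eab a b → Joins K4⁻ ebc b c → Joins K4⁻ eca c a →
  S a ≡ true → S b ≡ true → S c ≡ true → NegativeCycleIn K4⁻ S
K4⁻-negativeTriangle S eab ebc eca jab jbc jca sa sb sc =
  negativeTriangle {G = K4⁻} (proj₁ K4⁻-simple) {S} eab ebc eca jab jbc jca sa sb sc refl

missesOuter : (Fin 4 → Bool) → Bool
missesOuter S = not (S 0F) ∧ not (S 1F) ∧ not (S 2F)

classBound : (S : Fin 4 → Bool) → Balanced K4⁻ S → b2n (missesOuter S) + countTrue 4 S ≤ 2
classBound S balanced with S 0F in s0 | S 1F in s1 | S 2F in s2 | S 3F in s3
... | true  | true  | true  | _     = ⊥-elim (balanced (K4⁻-negativeTriangle S 0F 1F 2F fwd fwd fwd s0 s1 s2))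
... | true  | true  | false | true  = ⊥-elim (balanced (K4⁻-negativeTriangle S 0F 4F 3F fwd fwd bwd s0 s1 s3))
... | true  | false | true  | true  = ⊥-elim (balanced (K4⁻-negativeTriangle S 2F 5F 3F bwd fwd bwd s0 s2 s3))
... | false | true  | true  | true  = ⊥-elim (balanced (K4⁻-negativeTriangle S 1F 5F 4F fwd fwd bwd s1 s2 s3))
... | true  | true  | false | false = ≤-refl
... | true  | false | true  | false = ≤-refl
... | true  | false | false | true  = ≤-refl
... | true  | false | false | false = s≤s z≤n
... | false | true  | true  | false = ≤-refl
... | false | true  | false | true  = ≤-refl
... | false | true  | false | false = s≤s z≤n
... | false | false | true  | true  = ≤-refl
... | false | false | true  | false = s≤s z≤n
... | false | false | false | true  = ≤-refl
... | false | false | false | false = s≤s z≤n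

missing+4q≤2p : ∀ {p q} (c : BalancedColoring K4⁻ p q) →
  PlaneGraphNegOuterTriangle.missing K4⁻-plane c + 4 * q ≤ 2 * p
missing+4q≤2p {p} {q} c = begin
  countTrue p (missesOuter ∘ class) + 4 * q
    ≡⟨ cong₂ _+_ (countTrue≡∑ p (missesOuter ∘ class)) (sym (∑-classSizes c)) ⟩
  ∑[ i < p ] b2n (missesOuter (class i)) + ∑[ i < p ] countTrue 4 (class i)
    ≡⟨ ∑-distrib-+ (b2n ∘ missesOuter ∘ class) (countTrue 4 ∘ class) ⟨
  ∑[ i < p ] (b2n (missesOuter (class i)) + countTrue 4 (class i))
    ≤⟨ ∑-mono-≤ (λ i → classBound (class i) (balanced i)) ⟩
  ∑[ i < p ] 2
    ≡⟨ ∑-const p 2 ⟩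
  p * 2
    ≡⟨ *-comm p 2 ⟩
  2 * p ∎
  where
  open ≤-Reasoning
  open BalancedColoring c
  class : Fin p → Fin 4 → Bool
  class i v = col v i

lemma5 : (p q : ℕ) → 2 * q ≤ p → 2 * p ≤ 5 * q →
    Σ PlaneGraphNegOuterTriangle λ T →
      (c : BalancedColoring (PlaneGraphNegOuterTriangle.G T) p q) →
        PlaneGraphNegOuterTriangle.missing T c ≤ 2 * p ∸ 4 * q
lemma5 p q _ _ = K4⁻-plane , λ c → m+n≤o⇒m≤o∸n _ (missing+4q≤2p c)
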